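{- Let $\mathscr{A}$ be an implicative structure. For each separator $S\subseteq\mathscr{A}$ and all $a,b\in\mathscr{A}$, we have $(a\to b)\in S$ iff $b\in\mathrm{Sep}(S\cup\{a\})$.
   Context: An implicative structure is a complete lattice $(\mathscr{A},\preccurlyeq)$ (meets $\bigwedge$) with $\to$ anti-monotonic in its first and monotonic in its second argument, commuting with arbitrary meets in its second argument. A separator is an upwards closed subset containing $\bigwedge_{a,b}(a\to b\to a)$ and $\bigwedge_{a,b,c}((a\to b\to c)\to(a\to b)\to a\to c)$ and closed under modus ponens. For $X\subseteq\mathscr{A}$, $\mathrm{Sep}(X)$ denotes the smallest separator of $\mathscr{A}$ containing $X$ (the separator generated by $X$). -}

module Defs where

open import Level using (Level; suc; _⊔_)
open import Data.Product using (Σ; ∃; _×_; _,_)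
open import Data.Sum using (_⊎_)
open import Relation.Binary.PropositionalEquality using (_≡_)

Subset : ∀ {ℓ} → Set ℓ → Set (suc ℓ)
Subset {ℓ} A = A → Set ℓ

record ImplicativeStructure (ℓ : Level) : Set (suc ℓ) where
  infix  4 _≼_
  infixr 6 _⇒_
  field
    Carrier   : Set ℓ
    _≼_       : Carrier → Carrier → Set ℓ
    ≼-refl    : ∀ {a} → a ≼ a
    ≼-trans   : ∀ {a b c} → a ≼ b → b ≼ c → a ≼ c
    ≼-antisym : ∀ {a b} → a ≼ b → b ≼ a → a ≡ b
    ⋀         : Subset Carrier → Carrier
    ⋀-lower   : ∀ (X : Subset Carrier) {x} → X x → ⋀ X ≼ x
    ⋀-greatest : ∀ (X : Subset Carrier) {y} → (∀ {x} → X x → y ≼ x) → y ≼ ⋀ X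
    _⇒_       : Carrier → Carrier → Carrier
    ⇒-mono    : ∀ {a a' b b'} → a' ≼ a → b ≼ b' → (a ⇒ b) ≼ (a' ⇒ b')
    ⇒-⋀       : ∀ (a : Carrier) (B : Subset Carrier) →
                (a ⇒ ⋀ B) ≡ ⋀ (λ x → Σ Carrier (λ b → B b × (x ≡ (a ⇒ b))))

module _ {ℓ} (𝒜 : ImplicativeStructure ℓ) where
  open ImplicativeStructure 𝒜

  𝐊 : Carrier
  𝐊 = ⋀ (λ x → Σ Carrier (λ a → Σ Carrier (λ b → x ≡ (a ⇒ b ⇒ a))))

  𝐒 : Carrier
  𝐒 = ⋀ (λ x → Σ Carrier (λ a → Σ Carrier (λ b → Σ Carrier (λ c →
        x ≡ ((a ⇒ b ⇒ c) ⇒ (a ⇒ b) ⇒ a ⇒ c)))))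

  record IsSeparator (S : Subset Carrier) : Set ℓ where
    field
      upward : ∀ {a b} → S a → a ≼ b → S b
      K∈S    : S 𝐊
      S∈S    : S 𝐒
      mp     : ∀ {a b} → S (a ⇒ b) → S a → S b

  Sep : Subset Carrier → Carrier → Set (suc ℓ)
  Sep X x = ∀ (T : Subset Carrier) → IsSeparator T → (∀ {y} → X y → T y) → T x

  _∪｛_｝ : Subset Carrier → Carrier → Subset Carrier
  (X ∪｛ a ｝) y = X y ⊎ (y ≡ a)

module Submission where

-- Left to right is immediate: every separator containing S ∪ {a} contains
-- a ⇒ b and a, hence b by modus ponens; so b lies in their intersection.
--
-- Right to left uses the relativised set  S[a] = { x | a ⇒ x ∈ S }.  With the
-- combinators 𝐊 and 𝐒 one shows, as in the classical deduction theorem of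
-- Hilbert-style logic, that S[a] is itself a separator containing S (via 𝐊)
-- and a (via the identity 𝐒𝐊𝐊).  Hence S[a] ⊇ Sep(S ∪ {a}), and b ∈ S[a] is
-- exactly (a ⇒ b) ∈ S.

open import Defs
open import Function.Bundles using (_⇔_; mk⇔)
open import Data.Product using (_,_)
open import Data.Sum using (inj₁; inj₂)
open import Relation.Binary.PropositionalEquality using (refl)

module Combinators {ℓ} (𝒜 : ImplicativeStructure ℓ) where
  open ImplicativeStructure 𝒜

  𝐊-instance : ∀ x y → 𝐊 𝒜 ≼ (x ⇒ y ⇒ x)
  𝐊-instance x y = ⋀-lower _ (x , y , refl)

  𝐒-instance : ∀ x y z → 𝐒 𝒜 ≼ ((x ⇒ y ⇒ z) ⇒ (x ⇒ y) ⇒ x ⇒ z)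
  𝐒-instance x y z = ⋀-lower _ (x , y , z , refl)

  module _ {S : Subset Carrier} (sep : IsSeparator 𝒜 S) where
    open IsSeparator sep

    𝐊-instance∈ : ∀ x y → S (x ⇒ y ⇒ x)
    𝐊-instance∈ x y = upward K∈S (𝐊-instance x y)

    𝐒-instance∈ : ∀ x y z → S ((x ⇒ y ⇒ z) ⇒ (x ⇒ y) ⇒ x ⇒ z)
    𝐒-instance∈ x y z = upward S∈S (𝐒-instance x y z)

    -- The identity law x ⇒ x holds in every separator, as 𝐒𝐊𝐊 does in
    -- combinatory logic.
    ⇒-refl∈ : ∀ x → S (x ⇒ x)
    ⇒-refl∈ x = mp (mp (𝐒-instance∈ x (x ⇒ x) x) (𝐊-instance∈ x (x ⇒ x)))
                   (𝐊-instance∈ x x)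

module Generated {ℓ} (𝒜 : ImplicativeStructure ℓ) where
  open ImplicativeStructure 𝒜

  Sep-⊇ : ∀ {X : Subset Carrier} {x} → X x → Sep 𝒜 X x
  Sep-⊇ x∈X T _ X⊆T = X⊆T x∈X

  Sep-mp : ∀ {X : Subset Carrier} {x y} →
           Sep 𝒜 X (x ⇒ y) → Sep 𝒜 X x → Sep 𝒜 X y
  Sep-mp x⇒y∈ x∈ T T-sep X⊆T =
    IsSeparator.mp T-sep (x⇒y∈ T T-sep X⊆T) (x∈ T T-sep X⊆T)

module Relativised {ℓ} (𝒜 : ImplicativeStructure ℓ)
                   {S : Subset (ImplicativeStructure.Carrier 𝒜)}
                   (sep : IsSeparator 𝒜 S)
                   (a : ImplicativeStructure.Carrier 𝒜) where
  open ImplicativeStructure 𝒜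
  open IsSeparator sep
  open Combinators 𝒜

  S[a] : Subset Carrier
  S[a] x = S (a ⇒ x)

  S⊆S[a] : ∀ {x} → S x → S[a] x
  S⊆S[a] {x} x∈S = mp (𝐊-instance∈ sep x a) x∈S

  a∈S[a] : S[a] a
  a∈S[a] = ⇒-refl∈ sep a

  S[a]-mp : ∀ {x y} → S[a] (x ⇒ y) → S[a] x → S[a] y
  S[a]-mp {x} {y} x⇒y∈ x∈ = mp (mp (𝐒-instance∈ sep a x y) x⇒y∈) x∈

  S[a]-upward : ∀ {x y} → S[a] x → x ≼ y → S[a] y
  S[a]-upward x∈ x≼y = upward x∈ (⇒-mono ≼-refl x≼y)

  S[a]-separator : IsSeparator 𝒜 S[a]
  S[a]-separator = record
    { upward = S[a]-upward
    ; K∈S    = S⊆S[a] K∈S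
    ; S∈S    = S⊆S[a] S∈S
    ; mp     = S[a]-mp
    }

  S∪｛a｝⊆S[a] : ∀ {y} → _∪｛_｝ 𝒜 S a y → S[a] y
  S∪｛a｝⊆S[a] (inj₁ y∈S)  = S⊆S[a] y∈S
  S∪｛a｝⊆S[a] (inj₂ refl) = a∈S[a]

lemma3p10 : ∀ {ℓ} (𝒜 : ImplicativeStructure ℓ) →
    let open ImplicativeStructure 𝒜 in
    ∀ (S : Subset Carrier) → IsSeparator 𝒜 S → ∀ (a b : Carrier) →
    (S (a ⇒ b) ⇔ Sep 𝒜 (_∪｛_｝ 𝒜 S a) b)
lemma3p10 𝒜 S sep a b = mk⇔ deduce discharge
  where
  open ImplicativeStructure 𝒜 using (_⇒_)
  open Generated 𝒜
  open Relativised 𝒜 sep a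

  deduce : S (a ⇒ b) → Sep 𝒜 (_∪｛_｝ 𝒜 S a) b
  deduce a⇒b∈S = Sep-mp (Sep-⊇ (inj₁ a⇒b∈S)) (Sep-⊇ (inj₂ refl))

  discharge : Sep 𝒜 (_∪｛_｝ 𝒜 S a) b → S (a ⇒ b)
  discharge b∈Sep = b∈Sep S[a] S[a]-separator S∪｛a｝⊆S[a]
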